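{- Let $G$ be a graph and let $k\ge 1$, $c\ge 2$ and $r\ge 1$ be integers. If $G$ has a weak $kr$-guidance system of maximum outdegree at most $c$, then the $k$-distance power $G^k$ has a weak $r$-guidance system of maximum outdegree at most $2c^k$.
   Context: All graphs are finite, simple and undirected. A partial orientation of a graph $G$ is a directed graph $\vec{H}$ on vertex set $V(G)$ such that every arc $(u,v)$ of $\vec{H}$ satisfies $uv\in E(G)$; each edge of $G$ may be left undirected, directed one way, or directed both ways. The outdegree of a vertex is its number of out-arcs in $\vec{H}$. For $v\in V(G)$ and an integer $a\ge 0$, $B_{\vec{H}}(v,a)$ denotes the set of vertices reachable from $v$ by a directed path in $\vec{H}$ of length at most $a$. For a positive integer $r$, a weak $r$-guidance system of $G$ is a partial orientation $\vec{H}$ of $G$ such that for any distinct $u,v\in V(G)$ at distance $\ell\le r$ in $G$ there exist non-negative integers $a,b$ with $a+b=\ell-1$ such that $G$ contains an edge between a vertex of $B_{\vec{H}}(u,a)$ and a vertex of $B_{\vec{H}}(v,b)$. The $k$-distance power $G^k$ is the graph on $V(G)$ in which two distinct vertices are adjacent iff their distance in $G$ is at most $k$. -}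

module Defs where

open import Data.Nat using (ℕ; zero; suc; _+_; _*_; _^_; _≤_; _<_; _∸_)
open import Data.Fin using (Fin)
open import Data.Bool using (Bool; true; false; if_then_else_)
open import Data.List using (List; map)
open import Data.Nat.ListAction using (sum)
open import Data.List using (allFin)
open import Data.Product using (Σ; _×_; ∃; ∃-syntax; _,_)
open import Relation.Nullary using (¬_)
open import Relation.Binary using (Decidable)
open import Relation.Binary.PropositionalEquality using (_≡_; _≢_)

record Graph : Set₁ where
  field
    n      : ℕ
    Adj    : Fin n → Fin n → Set
    adj?   : Decidable Adj
    sym    : ∀ {u v} → Adj u v → Adj v u
    irrefl : ∀ {u} → ¬ Adj u u

data Walk {n : ℕ} (R : Fin n → Fin n → Set) : Fin n → Fin n → ℕ → Set where
  here : ∀ {u} → Walk R u u 0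
  step : ∀ {u w v ℓ} → R u w → Walk R w v ℓ → Walk R u v (suc ℓ)

Dist : {n : ℕ} → (Fin n → Fin n → Set) → Fin n → Fin n → ℕ → Set
Dist R u v ℓ = Walk R u v ℓ × (∀ m → m < ℓ → ¬ Walk R u v m)

record PartialOrientation {n : ℕ} (Adj : Fin n → Fin n → Set) : Set where
  field
    arc   : Fin n → Fin n → Bool
    sound : ∀ u v → arc u v ≡ true → Adj u v

Arc : {n : ℕ} {Adj : Fin n → Fin n → Set} → PartialOrientation Adj → Fin n → Fin n → Set
Arc H u v = PartialOrientation.arc H u v ≡ true

outdeg : {n : ℕ} {Adj : Fin n → Fin n → Set} → PartialOrientation Adj → Fin n → ℕ
outdeg {n} H u = sum (map (λ v → if PartialOrientation.arc H u v then 1 else 0) (allFin n))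

MaxOutdegAtMost : {n : ℕ} {Adj : Fin n → Fin n → Set} → PartialOrientation Adj → ℕ → Set
MaxOutdegAtMost {n} H c = ∀ (u : Fin n) → outdeg H u ≤ c

InBall : {n : ℕ} {Adj : Fin n → Fin n → Set} → PartialOrientation Adj → Fin n → ℕ → Fin n → Set
InBall H v a x = ∃[ m ] (m ≤ a × Walk (Arc H) v x m)

IsWeakGuidance : {n : ℕ} (Adj : Fin n → Fin n → Set) → ℕ → PartialOrientation Adj → Set
IsWeakGuidance {n} Adj r H =
  ∀ (u v : Fin n) (ℓ : ℕ) → u ≢ v → Dist Adj u v ℓ → ℓ ≤ r →
    ∃[ a ] ∃[ b ] (a + b ≡ ℓ ∸ 1 ×
      ∃[ x ] ∃[ y ] (InBall H u a x × InBall H v b y × Adj x y))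

PowAdj : (G : Graph) → ℕ → Fin (Graph.n G) → Fin (Graph.n G) → Set
PowAdj G k u v = u ≢ v × ∃[ ℓ ] (ℓ ≤ k × Dist (Graph.Adj G) u v ℓ)

{-# OPTIONS --safe #-}
-- Let H′ orient Gᵏ by an arc u → x whenever x ≠ u is the end of a nonempty H-walk from u of length
-- at most k; as c ≥ 2 there are at most c + c² + ⋯ + cᵏ ≤ 2cᵏ such x.  Given u, v at distance ℓ′
-- in Gᵏ, they are at distance ℓ ≤ kℓ′ in G, so H provides H-walks u ⇝ x and v ⇝ y of lengths
-- m, m′ with xy ∈ E(G) and m + m′ < kℓ′.  Cutting them into blocks of k steps gives H′-walks of
-- lengths ⌊m/k⌋, ⌊m′/k⌋ followed by H-walks of lengths α, β < k.  If α + β < k, the ends of the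
-- two H′-walks are joined in G by a walk of length α + 1 + β ≤ k; otherwise one more H′-arc
-- reaches x, which is joined to the other end by a walk of length β + 1 ≤ k.  Either way the two
-- radii sum to less than ℓ′, which forces the two ends to be distinct, hence adjacent in Gᵏ.
module Submission where

open import Defs
open import Data.Nat using (ℕ; _≤_; _*_; _^_)
open import Data.Product using (Σ; _×_; ∃-syntax)

open import Data.Bool using (Bool; true; false; if_then_else_; _∧_; _∨_; not)
open import Data.Bool.ListAction using (any)
open import Data.Empty using (⊥-elim)
open import Data.Fin using (Fin; _≟_)
open import Data.Fin.Properties using (any?)
open import Data.List using (List; []; _∷_; map; allFin)
open import Data.List.Membership.Propositional using (_∈_)
open import Data.List.Membership.Propositional.Properties using (∈-allFin)
open import Data.List.Relation.Unary.Any using (here; there)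
open import Data.Nat using (zero; suc; _+_; _<_; _∸_; z≤n; s≤s; _≤?_)
open import Data.Nat.DivMod using (_/_; _%_; m≡m%n+[m/n]*n; m%n<n)
open import Data.Nat.Induction using (<-rec)
open import Data.Nat.ListAction using (sum)
open import Data.Nat.Properties hiding (_≟_)
open import Data.Nat.Tactic.RingSolver using (solve-∀)
open import Data.Product using (_,_; proj₂)
open import Function using (_∘_)
open import Relation.Binary using (Decidable)
open import Relation.Binary.PropositionalEquality using (_≡_; _≢_; refl; sym; trans; cong; cong₂; subst)
open import Relation.Nullary using (¬_; Dec; yes; no)
open import Relation.Nullary.Decidable using (⌊_⌋; _×-dec_; map′)
open import Algebra.Properties.CommutativeSemigroup +-commutativeSemigroup using (interchange)

module _ {n : ℕ} where

  Walk-map : {R S : Fin n → Fin n → Set} → (∀ {a b} → R a b → S a b) →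
             ∀ {u v m} → Walk R u v m → Walk S u v m
  Walk-map f here       = here
  Walk-map f (step r p) = step (f r) (Walk-map f p)

  _++ʷ_ : {R : Fin n → Fin n → Set} → ∀ {u w v a b} →
          Walk R u w a → Walk R w v b → Walk R u v (a + b)
  here     ++ʷ q = q
  step r p ++ʷ q = step r (p ++ʷ q)

  Walk-splitAt : {R : Fin n → Fin n → Set} → ∀ a {b u v} →
                 Walk R u v (a + b) → ∃[ w ] (Walk R u w a × Walk R w v b)
  Walk-splitAt zero    p          = _ , here , p
  Walk-splitAt (suc a) (step r p) with Walk-splitAt a p
  ... | w , p₁ , p₂ = w , step r p₁ , p₂

  Walk-reverse : {R : Fin n → Fin n → Set} → (∀ {a b} → R a b → R b a) →
                 ∀ {u v m} → Walk R u v m → Walk R v u m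
  Walk-reverse sym′ here                 = here
  Walk-reverse sym′ {m = suc m} (step r p) =
    subst (Walk _ _ _) (+-comm m 1) (Walk-reverse sym′ p ++ʷ step (sym′ r) here)

  Walk-flatten : {R S : Fin n → Fin n → Set} {k : ℕ} →
                 (∀ {a b} → R a b → ∃[ L ] (L ≤ k × Walk S a b L)) →
                 ∀ {u v m} → Walk R u v m → ∃[ L ] (L ≤ m * k × Walk S u v L)
  Walk-flatten f here = 0 , z≤n , here
  Walk-flatten f (step r p) with f r | Walk-flatten f p
  ... | L₁ , L₁≤k , p₁ | L₂ , L₂≤ , p₂ = L₁ + L₂ , +-mono-≤ L₁≤k L₂≤ , p₁ ++ʷ p₂

  Walk-zero⇒≡ : {R : Fin n → Fin n → Set} → ∀ {u v} → Walk R u v 0 → u ≡ v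
  Walk-zero⇒≡ here = refl

  walk? : {R : Fin n → Fin n → Set} → Decidable R → ∀ m u v → Dec (Walk R u v m)
  walk? R? zero    u v = map′ (λ { refl → here }) Walk-zero⇒≡ (u ≟ v)
  walk? R? (suc m) u v =
    map′ (λ (w , r , p) → step r p) (λ { (step r p) → _ , r , p })
         (any? (λ w → R? u w ×-dec walk? R? m w v))

  Walk⇒Dist : {R : Fin n → Fin n → Set} → Decidable R →
              ∀ {u v m} → Walk R u v m → ∃[ ℓ ] (ℓ ≤ m × Dist R u v ℓ)
  Walk⇒Dist {R} R? {u} {v} {m} = <-rec Shortest shortest m
    where
    Shortest : ℕ → Set
    Shortest m = Walk R u v m → ∃[ ℓ ] (ℓ ≤ m × Dist R u v ℓ)

    shortest : ∀ m → (∀ {j} → j < m → Shortest j) → Shortest m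
    shortest m rec p with anyUpTo? (λ j → walk? R? j u v) m
    ... | yes (j , j<m , q) with rec j<m q
    ...   | ℓ , ℓ≤j , d = ℓ , ≤-trans ℓ≤j (<⇒≤ j<m) , d
    shortest m rec p | no none = m , ≤-refl , p , λ j j<m q → none (j , j<m , q)

  Dist-sym : {R : Fin n → Fin n → Set} → (∀ {a b} → R a b → R b a) →
             ∀ {u v ℓ} → Dist R u v ℓ → Dist R v u ℓ
  Dist-sym sym′ (p , shortest) = Walk-reverse sym′ p , λ j j<ℓ q → shortest j j<ℓ (Walk-reverse sym′ q)

GuidedAt : {n : ℕ} (Adj : Fin n → Fin n → Set) → PartialOrientation Adj → Fin n → Fin n → ℕ → Set
GuidedAt Adj H u v ℓ =
  ∃[ a ] ∃[ b ] (a + b ≡ ℓ ∸ 1 × ∃[ x ] ∃[ y ] (InBall H u a x × InBall H v b y × Adj x y))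

module _ {n : ℕ} {Adj : Fin n → Fin n → Set} (H : PartialOrientation Adj) where

  Arc⇒Adj : ∀ {u v} → Arc H u v → Adj u v
  Arc⇒Adj {u} {v} = PartialOrientation.sound H u v

  InBall-++ : ∀ {u x y a b} → InBall H u a x → InBall H x b y → InBall H u (a + b) y
  InBall-++ (i , i≤a , p) (j , j≤b , q) = i + j , +-mono-≤ i≤a j≤b , p ++ʷ q

  InBall-mono : ∀ {u x a b} → a ≤ b → InBall H u a x → InBall H u b x
  InBall-mono a≤b (i , i≤a , p) = i , ≤-trans i≤a a≤b , p

  balls-disjoint : (∀ {a b} → Adj a b → Adj b a) → ∀ {u v ℓ a b x} →
                   Dist Adj u v ℓ → a + b < ℓ → InBall H u a x → ¬ InBall H v b x
  balls-disjoint sym′ (_ , shortest) a+b<ℓ (i , i≤a , p) (j , j≤b , q) =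
    shortest (i + j) (≤-<-trans (+-mono-≤ i≤a j≤b) a+b<ℓ)
      (Walk-map Arc⇒Adj p ++ʷ Walk-reverse sym′ (Walk-map Arc⇒Adj q))

∧-true⁻ : ∀ a {b} → a ∧ b ≡ true → a ≡ true × b ≡ true
∧-true⁻ true e = refl , e

∧-true⁺ : ∀ {a b} → a ≡ true → b ≡ true → a ∧ b ≡ true
∧-true⁺ refl e = e

module _ {A : Set} where

  any-true⁻ : ∀ (f : A → Bool) xs → any f xs ≡ true → ∃[ x ] f x ≡ true
  any-true⁻ f (x ∷ xs) e with f x in fx
  ... | true  = x , fx
  ... | false = any-true⁻ f xs e

  any-true⁺ : ∀ (f : A → Bool) {x xs} → x ∈ xs → f x ≡ true → any f xs ≡ true
  any-true⁺ f (here refl) fx rewrite fx = refl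
  any-true⁺ f {xs = y ∷ _} (there x∈xs) fx with f y
  ... | true  = refl
  ... | false = any-true⁺ f x∈xs fx

  count : List A → (A → Bool) → ℕ
  count xs f = sum (map (λ x → if f x then 1 else 0) xs)

  count-false : ∀ xs → count xs (λ _ → false) ≡ 0
  count-false []       = refl
  count-false (_ ∷ xs) = count-false xs

  count-mono : ∀ xs {f g : A → Bool} → (∀ x → f x ≡ true → g x ≡ true) → count xs f ≤ count xs g
  count-mono []       f⇒g = z≤n
  count-mono (x ∷ xs) {f} {g} f⇒g = +-mono-≤ (indicator-mono (f x) (g x) (f⇒g x)) (count-mono xs f⇒g)
    where
    indicator-mono : ∀ b c → (b ≡ true → c ≡ true) → (if b then 1 else 0) ≤ (if c then 1 else 0)
    indicator-mono false c b⇒c = z≤n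
    indicator-mono true  c b⇒c rewrite b⇒c refl = ≤-refl

  count-∨ : ∀ xs (f g : A → Bool) → count xs (λ x → f x ∨ g x) ≤ count xs f + count xs g
  count-∨ []       f g = z≤n
  count-∨ (x ∷ xs) f g =
    ≤-trans (+-mono-≤ (indicator-∨ (f x) (g x)) (count-∨ xs f g)) (≤-reflexive (interchange (if f x then 1 else 0) _ (count xs f) _))
    where
    indicator-∨ : ∀ b c → (if b ∨ c then 1 else 0) ≤ (if b then 1 else 0) + (if c then 1 else 0)
    indicator-∨ false c = ≤-refl
    indicator-∨ true  c = s≤s z≤n

  count-any : {B : Set} → ∀ xs (ys : List B) (h : B → A → Bool) →
              count xs (λ x → any (λ y → h y x) ys) ≤ sum (map (λ y → count xs (h y)) ys)
  count-any xs []       h = ≤-reflexive (count-false xs)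
  count-any xs (y ∷ ys) h = ≤-trans (count-∨ xs (h y) _) (+-monoʳ-≤ (count xs (h y)) (count-any xs ys h))

  sum-map-mono : ∀ xs {f g : A → ℕ} → (∀ x → f x ≤ g x) → sum (map f xs) ≤ sum (map g xs)
  sum-map-mono []       f≤g = z≤n
  sum-map-mono (x ∷ xs) f≤g = +-mono-≤ (f≤g x) (sum-map-mono xs f≤g)

  sum-if : ∀ xs (f : A → Bool) t → sum (map (λ x → if f x then t else 0) xs) ≡ count xs f * t
  sum-if []       f t = refl
  sum-if (x ∷ xs) f t with f x
  ... | true  = cong (t +_) (sum-if xs f t)
  ... | false = sum-if xs f t

geometricSum : ℕ → ℕ → ℕ
geometricSum c zero    = 0
geometricSum c (suc j) = c + c * geometricSum c j

geometricSum-bound : ∀ {c} → 2 ≤ c → ∀ j → 2 + geometricSum c j ≤ 2 * c ^ j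
geometricSum-bound 2≤c zero = ≤-refl
geometricSum-bound {c} 2≤c (suc j) = begin
  2 + (c + c * s)  ≤⟨ +-monoˡ-≤ (c + c * s) 2≤c ⟩
  c + (c + c * s)  ≡⟨ factor c s ⟩
  c * (2 + s)      ≤⟨ *-monoʳ-≤ c (geometricSum-bound 2≤c j) ⟩
  c * (2 * c ^ j)  ≡⟨ swap c (c ^ j) ⟩
  2 * (c * c ^ j)  ∎
  where
  open ≤-Reasoning
  s : ℕ
  s = geometricSum c j
  factor : ∀ c s → c + (c + c * s) ≡ c * (2 + s)
  factor = solve-∀
  swap : ∀ c x → c * (2 * x) ≡ 2 * (c * x)
  swap = solve-∀

module _ {n : ℕ} (arc : Fin n → Fin n → Bool) where

  reach : ℕ → Fin n → Fin n → Bool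
  reach zero    u x = false
  reach (suc j) u x = arc u x ∨ any (λ y → arc u y ∧ reach j y x) (allFin n)

  count-reach : ∀ {c} → (∀ u → count (allFin n) (arc u) ≤ c) →
                ∀ j u → count (allFin n) (reach j u) ≤ geometricSum c j
  count-reach deg zero    u = ≤-reflexive (count-false (allFin n))
  count-reach {c} deg (suc j) u = begin
    count V (reach (suc j) u)
      ≤⟨ count-∨ V (arc u) _ ⟩
    count V (arc u) + count V (λ x → any (λ y → arc u y ∧ reach j y x) V)
      ≤⟨ +-monoʳ-≤ (count V (arc u)) (count-any V V (λ y x → arc u y ∧ reach j y x)) ⟩
    count V (arc u) + sum (map (λ y → count V (λ x → arc u y ∧ reach j y x)) V)
      ≤⟨ +-monoʳ-≤ (count V (arc u)) (sum-map-mono V via) ⟩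
    count V (arc u) + sum (map (λ y → if arc u y then geometricSum c j else 0) V)
      ≡⟨ cong (count V (arc u) +_) (sum-if V (arc u) (geometricSum c j)) ⟩
    count V (arc u) + count V (arc u) * geometricSum c j
      ≤⟨ +-mono-≤ (deg u) (*-monoˡ-≤ (geometricSum c j) (deg u)) ⟩
    c + c * geometricSum c j ∎
    where
    open ≤-Reasoning
    V : List (Fin n)
    V = allFin n
    via : ∀ y → count V (λ x → arc u y ∧ reach j y x) ≤ (if arc u y then geometricSum c j else 0)
    via y with arc u y
    ... | true  = count-reach deg j y
    ... | false = ≤-reflexive (count-false V)

module _ {n : ℕ} {Adj : Fin n → Fin n → Set} (H : PartialOrientation Adj) where
  open PartialOrientation H using (arc)

  reach-sound : ∀ j {u x} → reach arc j u x ≡ true → InBall H u j x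
  reach-sound (suc j) {u} {x} e with arc u x in u→x
  ... | true  = 1 , s≤s z≤n , step u→x here
  ... | false with any-true⁻ _ (allFin n) e
  ...   | y , e′ with ∧-true⁻ (arc u y) e′
  ...     | u→y , y↝x = InBall-++ H (1 , ≤-refl , step u→y here) (reach-sound j y↝x)

  reach-complete : ∀ {j u x m} → Walk (Arc H) u x (suc m) → suc m ≤ j → reach arc j u x ≡ true
  reach-complete {suc j} (step u→x here) _ rewrite u→x = refl
  reach-complete {suc j} {u} {x} (step {w = y} u→y p@(step _ _)) (s≤s m≤j) with arc u x
  ... | true  = refl
  ... | false = any-true⁺ _ (∈-allFin y) (∧-true⁺ u→y (reach-complete p m≤j))

quotients< : ∀ {q q′ k α β ℓ} → (q * k + α) + (q′ * k + β) < ℓ * k → q + q′ < ℓ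
quotients< {q} {q′} {k} {α} {β} {ℓ} lt =
  *-cancelʳ-< k (q + q′) ℓ (≤-<-trans (m≤n+m _ (α + β)) (subst (_< ℓ * k) (regroup q q′ k α β) lt))
  where
  regroup : ∀ q q′ k α β → (q * k + α) + (q′ * k + β) ≡ (α + β) + (q + q′) * k
  regroup = solve-∀

carried-quotients< : ∀ {q q′ k α β ℓ} → k ≤ α + β →
                     (q * k + α) + (q′ * k + β) < ℓ * k → (q + 1) + q′ < ℓ
carried-quotients< {q} {q′} {k} {α} {β} {ℓ} k≤α+β lt =
  subst (_< ℓ) (cong (_+ q′) (+-comm 1 q))
    (*-cancelʳ-< k (suc (q + q′)) ℓ
      (≤-<-trans (+-monoˡ-≤ ((q + q′) * k) k≤α+β) (subst (_< ℓ * k) (regroup q q′ k α β) lt)))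
  where
  regroup : ∀ q q′ k α β → (q * k + α) + (q′ * k + β) ≡ (α + β) + (q + q′) * k
  regroup = solve-∀

module PowerOrientation (G : Graph) (k₀ : ℕ) (H : PartialOrientation (Graph.Adj G)) where
  open Graph G using (n; Adj; adj?)
  open PartialOrientation H using (arc)

  k : ℕ
  k = suc k₀

  PowAdj⇒Walk : ∀ {p q} → PowAdj G k p q → ∃[ L ] (L ≤ k × Walk Adj p q L)
  PowAdj⇒Walk (_ , L , L≤k , p , _) = L , L≤k , p

  Walk⇒PowAdj : ∀ {p q L} → p ≢ q → L ≤ k → Walk Adj p q L → PowAdj G k p q
  Walk⇒PowAdj p≢q L≤k p with Walk⇒Dist adj? p
  ... | ℓ , ℓ≤L , d = p≢q , ℓ , ≤-trans ℓ≤L L≤k , d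

  PowAdj-sym : ∀ {p q} → PowAdj G k p q → PowAdj G k q p
  PowAdj-sym (p≢q , ℓ , ℓ≤k , d) = p≢q ∘ sym , ℓ , ℓ≤k , Dist-sym (Graph.sym G) d

  Dist-power : ∀ {u v ℓ′} → Dist (PowAdj G k) u v ℓ′ → ∃[ ℓ ] (ℓ ≤ ℓ′ * k × Dist Adj u v ℓ)
  Dist-power (p , _) with Walk-flatten PowAdj⇒Walk p
  ... | L , L≤ , q with Walk⇒Dist adj? q
  ... | ℓ , ℓ≤L , d = ℓ , ≤-trans ℓ≤L L≤ , d

  powerArc : Fin n → Fin n → Bool
  powerArc u x = not ⌊ u ≟ x ⌋ ∧ reach arc k u x

  powerArc-sound : ∀ u x → not ⌊ u ≟ x ⌋ ∧ reach arc k u x ≡ true → PowAdj G k u x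
  powerArc-sound u x e with u ≟ x
  ... | no u≢x with reach-sound H k e
  ...   | m , m≤k , p = Walk⇒PowAdj u≢x m≤k (Walk-map (Arc⇒Adj H) p)

  powerArc-intro : ∀ {u x} → u ≢ x → reach arc k u x ≡ true → not ⌊ u ≟ x ⌋ ∧ reach arc k u x ≡ true
  powerArc-intro {u} {x} u≢x e with u ≟ x
  ... | yes u≡x = ⊥-elim (u≢x u≡x)
  ... | no _    = e

  H′ : PartialOrientation (PowAdj G k)
  H′ = record { arc = powerArc ; sound = powerArc-sound }

  shortcut : ∀ {z x j} → j ≤ k → Walk (Arc H) z x j → InBall H′ z 1 x
  shortcut _ here = 0 , z≤n , here
  shortcut {z} {x} j≤k p@(step _ _) with z ≟ x
  ... | yes refl = 0 , z≤n , here
  ... | no z≢x   = 1 , ≤-refl , step (powerArc-intro z≢x (reach-complete H p j≤k)) here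

  compress : ∀ q {ρ u x} → Walk (Arc H) u x (q * k + ρ) → ∃[ z ] (InBall H′ u q z × Walk (Arc H) z x ρ)
  compress zero    p = _ , (0 , z≤n , here) , p
  compress (suc q) {ρ} p with Walk-splitAt k (subst (Walk (Arc H) _ _) (+-assoc k (q * k) ρ) p)
  ... | y , first , rest with compress q rest
  ...   | z , ball , tail = z , InBall-++ H′ (shortcut ≤-refl first) ball , tail

  Bridged : Fin n → Fin n → ℕ → Set
  Bridged u v ℓ = ∃[ a ] ∃[ b ] (a + b < ℓ × ∃[ p ] ∃[ q ]
    (InBall H′ u a p × InBall H′ v b q × ∃[ L ] (L ≤ k × Walk Adj p q L)))

  bridge-divided : ∀ {u v x y q q′ α β ℓ} → α < k → β < k →
    Walk (Arc H) u x (q * k + α) → Walk (Arc H) v y (q′ * k + β) → Adj x y →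
    (q * k + α) + (q′ * k + β) < ℓ * k → Bridged u v ℓ
  bridge-divided {x = x} {q = q} {q′} {α} {β} α<k β<k u→x v→y x~y bound
    with compress q u→x | compress q′ v→y | α + suc β ≤? k
  ... | z , ballᵤ , z→x | z′ , ballᵥ , z′→y | yes short =
    q , q′ , quotients< {q} {q′} {k} {α} {β} bound , z , z′ , ballᵤ , ballᵥ , _ , short ,
    Walk-map (Arc⇒Adj H) z→x ++ʷ step x~y (Walk-reverse (Graph.sym G) (Walk-map (Arc⇒Adj H) z′→y))
  ... | z , ballᵤ , z→x | z′ , ballᵥ , z′→y | no long =
    q + 1 , q′ , carried-quotients< {q} {q′} {k} {α} {β} k≤α+β bound , x , z′ ,
    InBall-++ H′ ballᵤ (shortcut (<⇒≤ α<k) z→x) , ballᵥ ,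
    _ , β<k , step x~y (Walk-reverse (Graph.sym G) (Walk-map (Arc⇒Adj H) z′→y))
    where
    k≤α+β : k ≤ α + β
    k≤α+β = ≤-pred (subst (k <_) (+-suc α β) (≰⇒> long))

  bridge : ∀ {u v x y m m′ ℓ} → Walk (Arc H) u x m → Walk (Arc H) v y m′ → Adj x y →
           m + m′ < ℓ * k → Bridged u v ℓ
  bridge {m = m} {m′} {ℓ} u→x v→y x~y bound =
    bridge-divided {q = m / k} {m′ / k} {m % k} {m′ % k} (m%n<n m k) (m%n<n m′ k) (divided u→x) (divided v→y) x~y
      (subst (_< ℓ * k) (cong₂ _+_ (euclid m) (euclid m′)) bound)
    where
    euclid : ∀ l → l ≡ l / k * k + l % k
    euclid l = trans (m≡m%n+[m/n]*n l k) (+-comm (l % k) _)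
    divided : ∀ {a b l} → Walk (Arc H) a b l → Walk (Arc H) a b (l / k * k + l % k)
    divided {l = l} = subst (Walk (Arc H) _ _) (euclid l)

  bridged⇒guided : ∀ {u v ℓ} → Dist (PowAdj G k) u v ℓ → Bridged u v ℓ → GuidedAt (PowAdj G k) H′ u v ℓ
  bridged⇒guided {ℓ = suc ℓ} dist (a , b , s≤s a+b≤ℓ , p , q , ballᵤ , ballᵥ , L , L≤k , p→q) with p ≟ q
  ... | yes refl = ⊥-elim (balls-disjoint H′ PowAdj-sym dist (s≤s a+b≤ℓ) ballᵤ ballᵥ)
  ... | no p≢q   =
    ℓ ∸ b , b , m∸n+n≡m (m+n≤o⇒n≤o a a+b≤ℓ) , p , q ,
    InBall-mono H′ (m+n≤o⇒m≤o∸n a a+b≤ℓ) ballᵤ , ballᵥ , Walk⇒PowAdj p≢q L≤k p→q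

  power-guidance : ∀ r → IsWeakGuidance Adj (k * r) H → IsWeakGuidance (PowAdj G k) r H′
  power-guidance r guided u v ℓ′ u≢v dist ℓ′≤r with Dist-power dist
  ... | zero , _ , p , _ = ⊥-elim (u≢v (Walk-zero⇒≡ p))
  ... | suc ℓ , ℓ<ℓ′k , distG
    with guided u v (suc ℓ) u≢v distG (≤-trans ℓ<ℓ′k (≤-trans (*-monoˡ-≤ k ℓ′≤r) (≤-reflexive (*-comm r k))))
  ... | a , b , a+b≡ℓ , x , y , (m , m≤a , u→x) , (m′ , m′≤b , v→y) , x~y =
    bridged⇒guided dist (bridge u→x v→y x~y
      (≤-trans (s≤s (subst (m + m′ ≤_) a+b≡ℓ (+-mono-≤ m≤a m′≤b))) ℓ<ℓ′k))

  power-outdeg : ∀ {c} → 2 ≤ c → MaxOutdegAtMost H c → MaxOutdegAtMost H′ (2 * c ^ k)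
  power-outdeg {c} 2≤c outdeg≤c u = begin
    outdeg H′ u                      ≤⟨ count-mono (allFin n) (λ x → proj₂ ∘ ∧-true⁻ _) ⟩
    count (allFin n) (reach arc k u) ≤⟨ count-reach arc outdeg≤c k u ⟩
    geometricSum c k                 ≤⟨ m≤n+m _ 2 ⟩
    2 + geometricSum c k             ≤⟨ geometricSum-bound 2≤c k ⟩
    2 * c ^ k                        ∎
    where open ≤-Reasoning

lemma5 : (G : Graph) (k c r : ℕ) → 1 ≤ k → 2 ≤ c → 1 ≤ r →
    (∃[ H ] (IsWeakGuidance (Graph.Adj G) (k * r) H × MaxOutdegAtMost H c)) →
    ∃[ H' ] (IsWeakGuidance (PowAdj G k) r H' × MaxOutdegAtMost H' (2 * c ^ k))
lemma5 G (suc k₀) c r _ 2≤c _ (H , guided , outdeg≤c) =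
  H′ , power-guidance r guided , power-outdeg 2≤c outdeg≤c
  where open PowerOrientation G k₀ H
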